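{- Let $A,B$ be process templates and consider conjunctive systems. For every $n \geq 1$ and every $\mathrm{LTL}\setminus\mathsf{X}$ formula $h(A,B_1)$: if $(A,B)^{(1,n)}$ has an unconditionally-fair initializing run satisfying $h(A,B_1)$, then $(A,B)^{(1,1)}$ has an unconditionally-fair initializing run satisfying $h(A,B_1)$.
   Context: A process template is $U=(Q_U,\mathrm{init}_U,\Sigma_U,\delta_U)$ with finite state set $Q_U$ containing initial state $\mathrm{init}_U$, finite input alphabet $\Sigma_U$, and guarded transition relation $\delta_U \subseteq Q_U \times \Sigma_U \times \mathcal{P}(Q_A \cup Q_B) \times Q_U$. $Q_A,Q_B$ are disjoint, as are $\Sigma_A,\Sigma_B$. The system $(A,B)^{(1,n)}$ consists of one copy $A$ of template $A$ and $n$ copies $B_1,\dots,B_n$ of $B$ in interleaving composition, starting with all processes in their initial states. A local transition $(q,\sigma,g,q')$ of process $p$ is enabled in global state $s$ with global input $e$ if $s(p)=q$, $e(p)=\sigma$ and (conjunctive interpretation) every process $p'\neq p$ has $s(p')\in g$; $\mathrm{init}_A,\mathrm{init}_B$ belong to every guard. Each global step moves exactly one process along an enabled local transition. A run is a maximal sequence of configurations $(s_t,e_t,p_t)$ from the initial state ($p_t$ the moving process; a $\bot$ configuration occurs exactly when all processes are disabled, ending the run), in which a process's input changes only when that process moves. A run is unconditionally-fair if every process moves infinitely often, and initializing if every process that moves infinitely often visits its initial state infinitely often. $h(A,B_1)$ is an LTL formula without next-time over propositions from $Q_A\cup\Sigma_A$ and from $Q_B\cup\Sigma_B$ indexed by $B_1$,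 evaluated on the local states and inputs of $A$ and $B_1$. -}

module Defs where

open import Data.Nat using (ℕ; zero; suc; _≤_; _<_)
open import Data.Fin using (Fin; fromℕ<)
open import Data.Bool using (Bool; true)
open import Data.Sum using (_⊎_; inj₁; inj₂)
open import Data.Product using (Σ; ∃; _×_; _,_; proj₁; proj₂)
open import Relation.Binary.PropositionalEquality using (_≡_)
open import Relation.Nullary using (¬_)

-- A guard is a subset of Q_A ∪ Q_B, represented by
-- its characteristic function on the disjoint union.
-- δ_U ⊆ Q_U × Σ_U × P(Q_A ∪ Q_B) × Q_U is given as a relation.

record Templates : Set₁ where
  field
    nQA nΣA nQB nΣB : ℕ
    initA : Fin nQA
    initB : Fin nQB

  QA = Fin nQA
  ΣA = Fin nΣA
  QB = Fin nQB
  ΣB = Fin nΣB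

  Guard : Set
  Guard = QA ⊎ QB → Bool

  _∈g_ : QA ⊎ QB → Guard → Set
  q ∈g g = g q ≡ true

  field
    δA : QA → ΣA → Guard → QA → Set
    δB : QB → ΣB → Guard → QB → Set

open Templates public

-- Standing assumption of conjunctive systems: init_A and init_B belong
-- to every guard (of every transition of A and of B).
InitInGuards : Templates → Set
InitInGuards T =
  (∀ q σ g q' → δA T q σ g q' →
     (_∈g_ T (inj₁ (initA T)) g) × (_∈g_ T (inj₂ (initB T)) g)) ×
  (∀ q σ g q' → δB T q σ g q' →
     (_∈g_ T (inj₁ (initA T)) g) × (_∈g_ T (inj₂ (initB T)) g))

data Proc (n : ℕ) : Set where
  pA : Proc n
  pB : Fin n → Proc n

module System (T : Templates) (n : ℕ) where

  record GState : Set where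
    constructor gstate
    field
      stA : QA T
      stB : Fin n → QB T

  record GInput : Set where
    constructor ginput
    field
      inA : ΣA T
      inB : Fin n → ΣB T

  record Config : Set where
    constructor config
    field
      st   : GState
      inp  : GInput
      proc : Proc n

  open GState public
  open GInput public
  open Config public

  initState : GState
  initState = gstate (initA T) (λ _ → initB T)

  Step : Config → GState → GInput → Set
  Step (config s e pA) s' e' =
    Σ (Guard T) λ g →
      δA T (stA s) (inA e) g (stA s') ×
      (∀ j → _∈g_ T (inj₂ (stB s j)) g) ×
      (∀ j → stB s' j ≡ stB s j) ×
      (∀ j → inB e' j ≡ inB e j)
  Step (config s e (pB i)) s' e' =
    Σ (Guard T) λ g →
      δB T (stB s i) (inB e i) g (stB s' i) ×
      (_∈g_ T (inj₁ (stA s)) g) ×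
      (∀ j → ¬ (j ≡ i) → _∈g_ T (inj₂ (stB s j)) g) ×
      (stA s' ≡ stA s) ×
      (∀ j → ¬ (j ≡ i) → stB s' j ≡ stB s j) ×
      (inA e' ≡ inA e) ×
      (∀ j → ¬ (j ≡ i) → inB e' j ≡ inB e j)

  -- A run: an infinite sequence of configurations starting in the
  -- initial global state, each consecutive pair related by a step.
  -- (Infinite sequences are maximal; finite runs ending in ⊥ are never
  -- unconditionally fair.)
  record Run : Set where
    field
      ρ       : ℕ → Config
      initial : st (ρ zero) ≡ initState
      steps   : ∀ t → Step (ρ t) (st (ρ (suc t))) (inp (ρ (suc t)))
  open Run public

  InfOften : (ℕ → Set) → Set
  InfOften P = ∀ t → ∃ λ t' → t ≤ t' × P t'

  Moves : Run → Proc n → ℕ → Set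
  Moves r p t = proc (ρ r t) ≡ p

  AtInit : Run → Proc n → ℕ → Set
  AtInit r pA     t = stA (st (ρ r t)) ≡ initA T
  AtInit r (pB i) t = stB (st (ρ r t)) i ≡ initB T

  UncondFair : Run → Set
  UncondFair r = ∀ p → InfOften (Moves r p)

  Initializing : Run → Set
  Initializing r = ∀ p → InfOften (Moves r p) → InfOften (AtInit r p)

data Atom (T : Templates) : Set where
  atStA  : QA T → Atom T
  atInA  : ΣA T → Atom T
  atStB1 : QB T → Atom T
  atInB1 : ΣB T → Atom T

data LTLX (T : Templates) : Set where
  atom  : Atom T → LTLX T
  ¬'_   : LTLX T → LTLX T
  _∧'_  : LTLX T → LTLX T → LTLX T
  _U'_  : LTLX T → LTLX T → LTLX T

module Semantics (T : Templates) (n : ℕ) (b1 : Fin n) where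
  open System T n

  holdsAtom : Config → Atom T → Set
  holdsAtom c (atStA q)  = stA (st c) ≡ q
  holdsAtom c (atInA σ)  = inA (inp c) ≡ σ
  holdsAtom c (atStB1 q) = stB (st c) b1 ≡ q
  holdsAtom c (atInB1 σ) = inB (inp c) b1 ≡ σ

  sat : (ℕ → Config) → ℕ → LTLX T → Set
  sat ρ i (atom a)  = holdsAtom (ρ i) a
  sat ρ i (¬' φ)    = ¬ sat ρ i φ
  sat ρ i (φ ∧' ψ)  = sat ρ i φ × sat ρ i ψ
  sat ρ i (φ U' ψ)  =
    ∃ λ k → i ≤ k × sat ρ k ψ × (∀ j → i ≤ j → j < k → sat ρ j φ)

-- The statement "(A,B)^(1,n) has an unconditionally-fair initializing
-- run satisfying h(A,B_1)", for n ≥ 1 (B_1 is process index 0).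
HasFairInitRun : (T : Templates) (n : ℕ) → 1 ≤ n → LTLX T → Set
HasFairInitRun T n 1≤n h =
  Σ (System.Run T n) λ r →
    System.UncondFair T n r × System.Initializing T n r ×
    Semantics.sat T n (fromℕ< 1≤n) (System.ρ r) 0 h

-- Project a fair initializing run of (A,B)^(1,n) onto A and B₁ by keeping only
-- the steps in which A or B₁ moves.  Between two such steps the local states and
-- inputs of A and B₁ do not change.  Since A
-- moves infinitely often the projection is an infinite run, fairness and
-- initialization carry over, and the original run is a stuttering of the
-- projected one on the atoms of h(A,B₁); LTL without next-time cannot
-- distinguish stutterings.
module Submission where

open import Defs
open import Data.Nat using (ℕ; zero; suc; _+_; _∸_; _≤_; _<_; _≤′_; ≤′-refl; ≤′-step; s≤s; z≤n)
open import Data.Nat.Properties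
open import Data.Fin using (Fin)
open import Data.Sum using (_⊎_; inj₁; inj₂)
open import Data.Product using (∃; _×_; _,_)
open import Data.Product.Function.NonDependent.Propositional using (_×-⇔_)
open import Function.Bundles using (_⇔_; mk⇔; Equivalence)
open import Relation.Binary.PropositionalEquality
open import Relation.Nullary using (¬_; yes; no; Dec)
open import Relation.Nullary.Negation using (contradiction; contraposition)
open import Relation.Unary using (Decidable)

open Equivalence using (to; from)

AllIn : (ℕ → Set) → ℕ → ℕ → Set
AllIn Q a b = ∀ s → a ≤ s → s < b → Q s

allIn-empty : ∀ {Q a} → AllIn Q a a
allIn-empty s a≤s s<a = contradiction s<a (≤⇒≯ a≤s)

allIn-cons : ∀ {Q a b} → Q a → AllIn Q (suc a) b → AllIn Q a b
allIn-cons Qa all s a≤s s<b with m≤n⇒m<n∨m≡n a≤s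
... | inj₁ a<s  = all s a<s s<b
... | inj₂ refl = Qa

allIn-tail : ∀ {Q a b} → AllIn Q a b → AllIn Q (suc a) b
allIn-tail all s a<s = all s (<⇒≤ a<s)

module Enumeration {P : ℕ → Set} (P? : Decidable P)
                   (recurs : ∀ t → ∃ λ t' → t ≤ t' × P t') where

  Avoids : ℕ → ℕ → Set
  Avoids = AllIn (λ s → ¬ P s)

  record FirstFrom (t : ℕ) : Set where
    field
      at     : ℕ
      t≤at   : t ≤ at
      P-at   : P at
      avoids : Avoids t at

  here : ∀ {t} → P t → FirstFrom t
  here {t} Pt = record { at = t ; t≤at = ≤-refl ; P-at = Pt ; avoids = allIn-empty }

  skip : ∀ {t} → ¬ P t → FirstFrom (suc t) → FirstFrom t
  skip ¬Pt first = record { at = at ; t≤at = <⇒≤ t≤at ; P-at = P-at ; avoids = allIn-cons ¬Pt avoids }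
    where open FirstFrom first

  firstWithin : ∀ d t → P (d + t) → FirstFrom t
  firstWithin zero    t Pt = here Pt
  firstWithin (suc d) t Pw with P? t
  ... | yes Pt = here Pt
  ... | no ¬Pt = skip ¬Pt (firstWithin d (suc t) (subst P (sym (+-suc d t)) Pw))

  next : ∀ t → FirstFrom t
  next t with recurs t
  ... | w , t≤w , Pw = firstWithin (w ∸ t) t (subst P (sym (m∸n+n≡m t≤w)) Pw)

  -- u k is the time of the k-th occurrence (counting from 0).
  u : ℕ → ℕ
  u zero    = FirstFrom.at (next 0)
  u (suc k) = FirstFrom.at (next (suc (u k)))

  P-u : ∀ k → P (u k)
  P-u zero    = FirstFrom.P-at (next 0)
  P-u (suc k) = FirstFrom.P-at (next (suc (u k)))

  -- count t is the number of occurrences strictly before t.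
  count : ℕ → ℕ
  count zero = zero
  count (suc t) with P? t
  ... | yes _ = suc (count t)
  ... | no  _ = count t

  count-step : ∀ t → count (suc t) ≡ count t ⊎ count (suc t) ≡ suc (count t)
  count-step t with P? t
  ... | yes _ = inj₂ refl
  ... | no  _ = inj₁ refl

  count-P : ∀ {t} → P t → count (suc t) ≡ suc (count t)
  count-P {t} Pt with P? t
  ... | yes _  = refl
  ... | no ¬Pt = contradiction Pt ¬Pt

  count-avoids : ∀ {a b} → a ≤ b → Avoids a b → count a ≡ count b
  count-avoids a≤b av = go (≤⇒≤′ a≤b) av
    where
    go : ∀ {a b} → a ≤′ b → Avoids a b → count a ≡ count b
    go ≤′-refl _ = refl
    go {a} {suc b} (≤′-step a≤′b) av with P? b
    ... | yes Pb = contradiction Pb (av b (≤′⇒≤ a≤′b) (n<1+n b))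
    ... | no  _  = go a≤′b (λ s a≤s s<b → av s a≤s (m<n⇒m<1+n s<b))

  count-u : ∀ k → count (u k) ≡ k
  count-u zero    = sym (count-avoids (FirstFrom.t≤at (next 0)) (FirstFrom.avoids (next 0)))
  count-u (suc k) = begin
    count (u (suc k))      ≡⟨ sym (count-avoids t≤at avoids) ⟩
    count (suc (u k))      ≡⟨ count-P (P-u k) ⟩
    suc (count (u k))      ≡⟨ cong suc (count-u k) ⟩
    suc k                  ∎
    where
    open ≡-Reasoning
    open FirstFrom (next (suc (u k)))

  avoids-from-P : ∀ {t a} → t ≤ a → Avoids t a → P t → a ≡ t
  avoids-from-P t≤a av Pt with m≤n⇒m<n∨m≡n t≤a
  ... | inj₁ t<a = contradiction Pt (av _ ≤-refl t<a)
  ... | inj₂ t≡a = sym t≡a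

  u-count : ∀ t → t ≤ u (count t) × Avoids t (u (count t))
  u-count zero = FirstFrom.t≤at (next 0) , FirstFrom.avoids (next 0)
  u-count (suc t) with P? t | u-count t
  ... | yes Pt | t≤a , av =
    subst (λ a → suc t ≤ FirstFrom.at (next (suc a)) × Avoids (suc t) (FirstFrom.at (next (suc a))))
          (sym (avoids-from-P t≤a av Pt))
          (FirstFrom.t≤at (next (suc t)) , FirstFrom.avoids (next (suc t)))
  ... | no ¬Pt | t≤a , av with m≤n⇒m<n∨m≡n t≤a
  ...   | inj₁ t<a = t<a , allIn-tail av
  ...   | inj₂ t≡a = contradiction (subst P (sym t≡a) (P-u (count t))) ¬Pt

  u-count-P : ∀ {t} → P t → u (count t) ≡ t
  u-count-P {t} Pt = let t≤a , av = u-count t in avoids-from-P t≤a av Pt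

-- f sends each time of a run to the corresponding time of its stutter-free version.
module Stuttering (f : ℕ → ℕ)
                  (f-step : ∀ t → f (suc t) ≡ f t ⊎ f (suc t) ≡ suc (f t))
                  (f-unbounded : ∀ k → ∃ λ t → k ≤ f t) where

  f-≤-suc : ∀ t → f t ≤ f (suc t)
  f-≤-suc t with f-step t
  ... | inj₁ eq = ≤-reflexive (sym eq)
  ... | inj₂ eq = subst (f t ≤_) (sym eq) (n≤1+n (f t))

  f-suc-≤ : ∀ t → f (suc t) ≤ suc (f t)
  f-suc-≤ t with f-step t
  ... | inj₁ eq = subst (_≤ suc (f t)) (sym eq) (n≤1+n (f t))
  ... | inj₂ eq = ≤-reflexive eq

  f-mono : ∀ {s t} → s ≤ t → f s ≤ f t
  f-mono {s} s≤t = go (≤⇒≤′ s≤t)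
    where
    go : ∀ {t} → s ≤′ t → f s ≤ f t
    go ≤′-refl        = ≤-refl
    go (≤′-step s≤′t) = ≤-trans (go s≤′t) (f-≤-suc _)

  f-<-cancel : ∀ {s t} → f s < f t → s < t
  f-<-cancel fs<ft = ≰⇒> (λ t≤s → <⇒≱ fs<ft (f-mono t≤s))

  infOften-map : ∀ {Q Q' : ℕ → Set} → (∀ t → Q t → Q' (f t)) →
                 (∀ t → ∃ λ t' → t ≤ t' × Q t') → (∀ k → ∃ λ k' → k ≤ k' × Q' k')
  infOften-map Q⇒Q' often k with f-unbounded k
  ... | t , k≤ft with often t
  ...   | t' , t≤t' , Qt' = f t' , ≤-trans k≤ft (f-mono t≤t') , Q⇒Q' t' Qt'

  record FirstHit (t k : ℕ) : Set where
    field
      at    : ℕ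
      t≤at  : t ≤ at
      hits  : f at ≡ k
      below : AllIn (λ s → f s < k) t at

  hitWithin : ∀ d {t k} → f t ≤ k → k ≤ f (d + t) → FirstHit t k
  hitWithin d {t} ft≤k k≤f with m≤n⇒m<n∨m≡n ft≤k
  ... | inj₂ ft≡k = record { at = t ; t≤at = ≤-refl ; hits = ft≡k ; below = allIn-empty }
  hitWithin zero    ft≤k k≤f | inj₁ ft<k = contradiction k≤f (<⇒≱ ft<k)
  hitWithin (suc d) {t} {k} ft≤k k≤f | inj₁ ft<k =
    record { at = at ; t≤at = <⇒≤ t≤at ; hits = hits ; below = allIn-cons ft<k below }
    where
    open FirstHit (hitWithin d (≤-trans (f-suc-≤ t) ft<k) (subst (λ x → k ≤ f x) (sym (+-suc d t)) k≤f))

  -- A discrete intermediate value theorem.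
  firstHit : ∀ {t k} → f t ≤ k → FirstHit t k
  firstHit {t} {k} ft≤k with f-unbounded k
  ... | t'' , k≤ft'' = hitWithin t'' ft≤k (≤-trans k≤ft'' (f-mono (m≤m+n t'' t)))

module StutterInvariance (T : Templates) {n n' : ℕ} (b : Fin n) (b' : Fin n')
    (ρ : ℕ → System.Config T n) (ρ' : ℕ → System.Config T n')
    (f : ℕ → ℕ)
    (f-step : ∀ t → f (suc t) ≡ f t ⊎ f (suc t) ≡ suc (f t))
    (f-unbounded : ∀ k → ∃ λ t → k ≤ f t)
    (atoms : ∀ t a → Semantics.holdsAtom T n b (ρ t) a ⇔ Semantics.holdsAtom T n' b' (ρ' (f t)) a)
    where

  open Stuttering f f-step f-unbounded
  module S  = Semantics T n b
  module S' = Semantics T n' b'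

  Agree : LTLX T → Set
  Agree φ = ∀ t → S.sat ρ t φ ⇔ S'.sat ρ' (f t) φ

  until-to : ∀ {φ ψ} → Agree φ → Agree ψ → ∀ {t} → S.sat ρ t (φ U' ψ) → S'.sat ρ' (f t) (φ U' ψ)
  until-to {φ} φ≈ ψ≈ {t} (t' , t≤t' , ψt' , φ-before) =
    f t' , f-mono t≤t' , to (ψ≈ t') ψt' , φ'-before
    where
    φ'-before : AllIn (λ j → S'.sat ρ' j φ) (f t) (f t')
    φ'-before j ft≤j j<ft' = subst (λ k → S'.sat ρ' k φ) hits
      (to (φ≈ at) (φ-before at t≤at (f-<-cancel (subst (_< f t') (sym hits) j<ft'))))
      where open FirstHit (firstHit ft≤j)

  until-from : ∀ {φ ψ} → Agree φ → Agree ψ → ∀ {t} → S'.sat ρ' (f t) (φ U' ψ) → S.sat ρ t (φ U' ψ)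
  until-from {φ} {ψ} φ≈ ψ≈ {t} (k , ft≤k , ψk , φ'-before) =
    at , t≤at , from (ψ≈ at) (subst (λ j → S'.sat ρ' j ψ) (sym hits) ψk) ,
    λ s t≤s s<at → from (φ≈ s) (φ'-before (f s) (f-mono t≤s) (below s t≤s s<at))
    where open FirstHit (firstHit ft≤k)

  sat-stutter : ∀ φ → Agree φ
  sat-stutter (atom a) t = atoms t a
  sat-stutter (¬' φ)   t = mk⇔ (contraposition (from (sat-stutter φ t))) (contraposition (to (sat-stutter φ t)))
  sat-stutter (φ ∧' ψ) t = sat-stutter φ t ×-⇔ sat-stutter ψ t
  sat-stutter (φ U' ψ) t =
    mk⇔ (until-to {φ} {ψ} (sat-stutter φ) (sat-stutter ψ)) (until-from {φ} {ψ} (sat-stutter φ) (sat-stutter ψ))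

record LocalView (T : Templates) : Set where
  constructor localView
  field
    stateA  : QA T
    inputA  : ΣA T
    stateB  : QB T
    inputB  : ΣB T

open LocalView

view : ∀ {T n} → Fin n → System.Config T n → LocalView T
view {T} {n} b c = localView (stA (st c)) (inA (inp c)) (stB (st c) b) (inB (inp c) b)
  where open System T n

localView-cong : ∀ {T} {q q' : QA T} {σ σ' : ΣA T} {r r' : QB T} {τ τ' : ΣB T} →
                 q ≡ q' → σ ≡ σ' → r ≡ r' → τ ≡ τ' → localView {T} q σ r τ ≡ localView q' σ' r' τ'
localView-cong refl refl refl refl = refl

holdsAtom-view : ∀ {T n n'} {b : Fin n} {b' : Fin n'} {c c'} → view b c ≡ view b' c' →
                 ∀ a → Semantics.holdsAtom T n b c a ⇔ Semantics.holdsAtom T n' b' c' a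
holdsAtom-view eq (atStA _)  = mk⇔ (trans (sym (cong stateA eq))) (trans (cong stateA eq))
holdsAtom-view eq (atInA _)  = mk⇔ (trans (sym (cong inputA eq))) (trans (cong inputA eq))
holdsAtom-view eq (atStB1 _) = mk⇔ (trans (sym (cong stateB eq))) (trans (cong stateB eq))
holdsAtom-view eq (atInB1 _) = mk⇔ (trans (sym (cong inputB eq))) (trans (cong inputB eq))

module Projection (T : Templates) (m : ℕ) where
  module N = System T (suc m)
  module O = System T 1

  data Tracked : Proc (suc m) → Set where
    trackedA  : Tracked pA
    trackedB₁ : Tracked (pB Fin.zero)

  tracked? : ∀ p → Dec (Tracked p)
  tracked? pA                = yes trackedA
  tracked? (pB Fin.zero)     = yes trackedB₁
  tracked? (pB (Fin.suc _))  = no λ ()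

  projectProc : Proc (suc m) → Proc 1
  projectProc pA     = pA
  projectProc (pB _) = pB Fin.zero

  project : N.Config → O.Config
  project c = O.config (O.gstate (N.stA (N.st c)) (λ _ → N.stB (N.st c) Fin.zero))
                       (O.ginput (N.inA (N.inp c)) (λ _ → N.inB (N.inp c) Fin.zero))
                       (projectProc (N.proc c))

  untracked-step-view : ∀ c c₁ → ¬ Tracked (N.proc c) → N.Step c (N.st c₁) (N.inp c₁) →
                        view Fin.zero c ≡ view Fin.zero c₁
  untracked-step-view (N.config _ _ pA)            _ untracked _ = contradiction trackedA untracked
  untracked-step-view (N.config _ _ (pB Fin.zero)) _ untracked _ = contradiction trackedB₁ untracked
  untracked-step-view (N.config _ _ (pB (Fin.suc _))) _ _ (_ , _ , _ , _ , stA≡ , stB≡ , inA≡ , inB≡) =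
    localView-cong (sym stA≡) (sym inA≡) (sym (stB≡ Fin.zero λ ())) (sym (inB≡ Fin.zero λ ()))

  tracked-step-project : ∀ c c₁ c₂ → Tracked (N.proc c) → N.Step c (N.st c₁) (N.inp c₁) →
                         view Fin.zero c₁ ≡ view Fin.zero c₂ →
                         O.Step (project c) (O.st (project c₂)) (O.inp (project c₂))
  tracked-step-project (N.config s e pA) _ _ trackedA (g , δ , B∈g , stB≡ , inB≡) eq =
    g , subst (δA T (N.stA s) (N.inA e) g) (cong stateA eq) δ , (λ _ → B∈g Fin.zero) ,
    (λ _ → trans (sym (cong stateB eq)) (stB≡ Fin.zero)) ,
    (λ _ → trans (sym (cong inputB eq)) (inB≡ Fin.zero))
  tracked-step-project (N.config s e (pB Fin.zero)) _ _ trackedB₁ (g , δ , A∈g , _ , stA≡ , _ , inA≡ , _) eq =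
    g , subst (δB T (N.stB s Fin.zero) (N.inB e Fin.zero) g) (cong stateB eq) δ , A∈g ,
    (λ { Fin.zero 0≢0 → contradiction refl 0≢0 }) ,
    trans (sym (cong stateA eq)) stA≡ ,
    (λ { Fin.zero 0≢0 → contradiction refl 0≢0 }) ,
    trans (sym (cong inputA eq)) inA≡ ,
    (λ { Fin.zero 0≢0 → contradiction refl 0≢0 })

  module OnRun (r : N.Run) (fair : N.UncondFair r) (init : N.Initializing r) where
    ρ : ℕ → N.Config
    ρ = N.ρ r

    tracked-recurs : ∀ t → ∃ λ t' → t ≤ t' × Tracked (N.proc (ρ t'))
    tracked-recurs t with fair pA t
    ... | t' , t≤t' , movesA = t' , t≤t' , subst Tracked (sym movesA) trackedA

    open Enumeration (λ t → tracked? (N.proc (ρ t))) tracked-recurs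

    view-avoids : ∀ {a b} → a ≤ b → Avoids a b → view Fin.zero (ρ a) ≡ view Fin.zero (ρ b)
    view-avoids a≤b av = go (≤⇒≤′ a≤b) av
      where
      go : ∀ {a b} → a ≤′ b → Avoids a b → view Fin.zero (ρ a) ≡ view Fin.zero (ρ b)
      go ≤′-refl _ = refl
      go {a} {suc b} (≤′-step a≤′b) av =
        trans (go a≤′b (λ s a≤s s<b → av s a≤s (m<n⇒m<1+n s<b)))
              (untracked-step-view (ρ b) (ρ (suc b)) (av b (≤′⇒≤ a≤′b) (n<1+n b)) (N.steps r b))

    view-u-count : ∀ t → view Fin.zero (ρ t) ≡ view Fin.zero (ρ (u (count t)))
    view-u-count t = let t≤a , av = u-count t in view-avoids t≤a av

    ρ' : ℕ → O.Config
    ρ' k = project (ρ (u k))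

    run : O.Run
    run = record { ρ = ρ' ; initial = initial ; steps = steps }
      where
      initial : O.st (ρ' 0) ≡ O.initState
      initial = cong₂ O.gstate
        (trans (sym (cong stateA (view-u-count 0))) (cong N.stA (N.initial r)))
        (cong (λ q (_ : Fin 1) → q)
              (trans (sym (cong stateB (view-u-count 0))) (cong (λ s → N.stB s Fin.zero) (N.initial r))))
      steps : ∀ k → O.Step (ρ' k) (O.st (ρ' (suc k))) (O.inp (ρ' (suc k)))
      steps k = tracked-step-project (ρ (u k)) (ρ (suc (u k))) (ρ (u (suc k))) (P-u k) (N.steps r (u k))
                  (view-avoids t≤at avoids)
        where open FirstFrom (next (suc (u k)))

    atoms : ∀ t a → Semantics.holdsAtom T (suc m) Fin.zero (ρ t) a ⇔
                    Semantics.holdsAtom T 1 Fin.zero (ρ' (count t)) a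
    atoms t = holdsAtom-view (view-u-count t)

    count-unbounded : ∀ k → ∃ λ t → k ≤ count t
    count-unbounded k = u k , ≤-reflexive (sym (count-u k))

    open Stuttering count count-step count-unbounded using (infOften-map)
    open StutterInvariance T Fin.zero Fin.zero ρ ρ' count count-step count-unbounded atoms public
      using (sat-stutter)

    moves-project : ∀ {p} → Tracked p → ∀ t → N.Moves r p t → O.Moves run (projectProc p) (count t)
    moves-project {p} tracked t moves =
      cong projectProc (trans (cong (λ s → N.proc (ρ s)) (u-count-P (subst Tracked (sym moves) tracked))) moves)

    fair' : O.UncondFair run
    fair' pA            = infOften-map (moves-project trackedA) (fair pA)
    fair' (pB Fin.zero) = infOften-map (moves-project trackedB₁) (fair (pB Fin.zero))

    -- Being at the initial state is itself an atom of the logic.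
    init' : O.Initializing run
    init' pA _            = infOften-map (λ t → to (atoms t (atStA (initA T)))) (init pA (fair pA))
    init' (pB Fin.zero) _ =
      infOften-map (λ t → to (atoms t (atStB1 (initB T)))) (init (pB Fin.zero) (fair (pB Fin.zero)))

lemma14 : (T : Templates) → InitInGuards T →
    (n : ℕ) (1≤n : 1 ≤ n) (h : LTLX T) →
    HasFairInitRun T n 1≤n h → HasFairInitRun T 1 (s≤s z≤n) h
lemma14 T _ (suc m) (s≤s z≤n) h (r , fair , init , sat-h) =
  run , fair' , init' , to (sat-stutter h 0) sat-h
  where
  open Projection T m
  open OnRun r fair init
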